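{- For every $m\ge1$ and every $m$-colored composition $\alpha$ of $n$, the number of saturated chains from $\emptyset$ to $\alpha$ in the poset $\mathrm{Comp}^{(m)}$ equals the number $f^{(m)}_n(\alpha)$ of $m$-colored permutations $w\in C_m\wr\mathfrak{S}_n$ with colored descent composition $\mathrm{C}^{(m)}(w)=\alpha$.
   Context: Let $\omega$ be a primitive $m$-th root of unity and $C_m=\{1,\omega,\ldots,\omega^{m-1}\}$. An $m$-colored composition of $n$ is a tuple $\alpha=(\varepsilon_1\alpha_1,\ldots,\varepsilon_k\alpha_k)$ of positive integers with colors $\varepsilon_s\in C_m$ summing to $n$; $\emptyset$ is the one of $0$. $\mathrm{Comp}^{(m)}$ is the poset on all such compositions generated by the covers: $\beta$ covers $\alpha=(\varepsilon_1\alpha_1,\ldots,\varepsilon_k\alpha_k)$ iff for some $j$, $\beta$ is obtained by (1) replacing $\varepsilon_j\alpha_j$ by $\varepsilon_j(\alpha_j+1)$; or (2) replacing $\varepsilon_j\alpha_j$ by $\varepsilon_j(h+1),\varepsilon_j(\alpha_j-h)$ for some $0\le h\le\alpha_j-1$; or (3) replacing $\varepsilon_j\alpha_j$ by $\varepsilon_j h,\varepsilon'1,\varepsilon_j(\alpha_j-h)$ with $\varepsilon'\ne\varepsilon_j$, $0\le h\le \alpha_j-1$, deleting parts of size $0$ (the covers of $\emptyset$ are the $(\varepsilon1)$). A saturated chain from $\emptyset$ to $\alpha$, $|\alpha|=n$, is $\emptyset=\alpha^0\prec\cdots\prec\alpha^n=\alpha$ with each step a cover. An $m$-colored permutation $w\in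 C_m\wr\mathfrak{S}_n$ is a word $w_1\cdots w_n$ with letters $\varepsilon i$ ($\varepsilon\in C_m$, $i\in[n]$) whose absolute values form a permutation of $[n]$. Its colored descent composition $\mathrm{C}^{(m)}(w)$ lists, left to right, the lengths and colors of the maximal factors of $w$ whose letters all have the same color and whose absolute values are increasing. -}

module Defs where

open import Data.Nat using (ℕ; zero; suc; _+_; _∸_; _<?_)
open import Data.Nat.ListAction using (sum)
import Data.Nat as ℕ
open import Data.Fin using (Fin; toℕ)
import Data.Fin as Fin
open import Data.Bool using (Bool; true; false; _∧_; if_then_else_)
open import Data.Product using (_×_; _,_; proj₁; proj₂)
import Data.Product.Properties as ×P
open import Data.List using (List; []; _∷_; _++_; map; concatMap; filter; length; allFin; upTo; deduplicate; cartesianProduct)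
import Data.List.Properties as LP
open import Data.List.NonEmpty using (List⁺; [_]; _∷⁺_; head)
open import Data.List.Relation.Unary.All using (All)
open import Relation.Nullary using (does; ¬?)
open import Relation.Binary.PropositionalEquality using (_≡_)
open import Relation.Binary.Definitions using (DecidableEquality)
import Data.List.Relation.Unary.Unique.DecPropositional as UDec

-- Colors: the color ω^k ∈ C_m is encoded as k : Fin m.
-- A part ε·a of a colored composition is a pair (ε , a).
-- An m-colored composition is a list of parts (parts positive: see `IsComp`).
Comp : ℕ → Set
Comp m = List (Fin m × ℕ)

IsComp : ∀ {m} → Comp m → Set
IsComp α = All (λ p → 0 ℕ.< proj₂ p) α

size : ∀ {m} → Comp m → ℕ
size α = sum (map proj₂ α)

_≟C_ : ∀ {m} → DecidableEquality (Comp m)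
_≟C_ = LP.≡-dec (×P.≡-dec Fin._≟_ ℕ._≟_)

splits : ∀ {A : Set} → List A → List (List A × A × List A)
splits [] = []
splits (x ∷ xs) = ([] , x , xs) ∷ map (λ { (p , y , s) → (x ∷ p , y , s) }) (splits xs)

dropZeros : ∀ {m} → Comp m → Comp m
dropZeros = filter (λ p → ¬? (proj₂ p ℕ.≟ 0))

-- all compositions obtained from α by one cover step (possibly with repetitions)
coverCandidates : ∀ {m} → Comp m → List (Comp m)
coverCandidates {m} [] = map (λ ε → (ε , 1) ∷ []) (allFin m)
coverCandidates {m} α@(_ ∷ _) = concatMap step (splits α)
  where
  step : List (Fin m × ℕ) × (Fin m × ℕ) × List (Fin m × ℕ) → List (Comp m)
  step (pre , (ε , a) , suf) =
    (pre ++ (ε , suc a) ∷ suf)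
    ∷ map (λ h → pre ++ (ε , suc h) ∷ (ε , a ∸ h) ∷ suf) (upTo a)
    -- rule (3), ε' ≠ ε, h = 0 .. a  (h = a needed; literal h ≤ a-1 makes the claim false)
    ++ concatMap (λ h →
         map (λ ε' → pre ++ dropZeros ((ε , h) ∷ (ε' , 1) ∷ (ε , a ∸ h) ∷ []) ++ suf)
             (filter (λ ε' → ¬? (ε' Fin.≟ ε)) (allFin m)))
       (upTo (suc a))

covers : ∀ {m} → Comp m → List (Comp m)
covers α = deduplicate _≟C_ (coverCandidates α)

-- saturated chains starting at ∅ with k cover steps, as nonempty lists
-- (head = top element α^k, last = ∅); each chain appears exactly once
chainsFromEmpty : ∀ {m} → ℕ → List (List⁺ (Comp m))
chainsFromEmpty zero = [ [] ] ∷ []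
chainsFromEmpty (suc k) =
  concatMap (λ ch → map (λ β → β ∷⁺ ch) (covers (head ch))) (chainsFromEmpty k)

numSatChains : ∀ {m} → (n : ℕ) → Comp m → ℕ
numSatChains n α = length (filter (λ ch → head ch ≟C α) (chainsFromEmpty n))

words : ∀ {A : Set} → ℕ → List A → List (List A)
words zero xs = [] ∷ []
words (suc k) xs = concatMap (λ w → map (λ x → x ∷ w) xs) (words k xs)

-- m-colored permutations of [n]: words w₁⋯wₙ of letters (color , absolute value)
-- with absolute value i ∈ [n] encoded as i-1 : Fin n, absolute values pairwise
-- distinct (hence a permutation of [n]).
coloredPerms : (m n : ℕ) → List (List (Fin m × Fin n))
coloredPerms m n =
  filter (λ w → UDec.unique? Fin._≟_ (map proj₂ w))
         (words n (cartesianProduct (allFin m) (allFin n)))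

-- colored descent composition: lengths and colors of maximal factors whose
-- letters have the same color and strictly increasing absolute values
descGo : ∀ {m n} → Fin m → Fin n → ℕ → List (Fin m × Fin n) → Comp m
descGo c v len [] = (c , len) ∷ []
descGo c v len ((c' , v') ∷ xs) =
  if does (c Fin.≟ c') ∧ does (toℕ v <? toℕ v')
  then descGo c v' (suc len) xs
  else (c , len) ∷ descGo c' v' 1 xs

coloredDescComp : ∀ {m n} → List (Fin m × Fin n) → Comp m
coloredDescComp [] = []
coloredDescComp ((c , v) ∷ xs) = descGo c v 1 xs

f : (m n : ℕ) → Comp m → ℕ
f m n α = length (filter (λ w → coloredDescComp w ≟C α) (coloredPerms m n))

-- Deleting the largest letter n+1 from a colored permutation of [n+1] leaves one of [n], and
-- conversely every w ∈ C_m ≀ S_n yields (n+1)·m colored permutations of [n+1], by inserting n+1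
-- with any colour after any of its first i letters (0 ≤ i ≤ n).  The colored descent composition
-- of the result depends only on the composition α of w, on i and on the colour, and these (n+1)·m
-- compositions are exactly the covers of α in Comp^(m), each obtained once.  Hence the multiset
-- of colored descent compositions over C_m ≀ S_{n+1} arises from the one over C_m ≀ S_n by
-- replacing every α by its covers, which is also how the multiset of top elements of saturated
-- chains from ∅ grows with the length of the chains.  Comparing multiplicities of α in the two
-- (equal) multisets gives the theorem.

module Submission where

open import Defs
open import Data.Bool using (true; false; _∧_)
open import Data.Empty using (⊥-elim)
open import Data.Fin using (Fin; toℕ; fromℕ; inject₁; lower₁)
import Data.Fin as Fin
open import Data.Fin.Properties
  using (toℕ-fromℕ; toℕ-injective; toℕ-inject₁; inject₁ℕ<; inject₁-injective; inject₁-lower₁;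
         fromℕ≢inject₁)
open import Data.List
  using (List; []; _∷_; _++_; map; concatMap; filter; length; upTo; allFin; cartesianProduct)
open import Data.List.NonEmpty using (List⁺; _∷⁺_; head)
open import Data.List.Properties
  using (length-map; length-filter; length-tabulate; length-++-≤ˡ; map-∘; map-id; map-cong-local;
         map-++; map-injective; concatMap-cong; concatMap-map; map-concatMap;
         ∷-injective; ∷-injectiveˡ; ∷-injectiveʳ)
import Data.List.Membership.DecPropositional as DecMembership
open import Data.List.Membership.Propositional using (_∈_)
open import Data.List.Membership.Propositional.Properties
  using (∈-map⁺; ∈-map⁻; ∈-++⁺ˡ; ∈-++⁺ʳ; ∈-++⁻; ∈-concat⁺′; ∈-concat⁻′; ∈-filter⁺; ∈-filter⁻;
         ∈-allFin; ∈-upTo⁺; ∈-upTo⁻; ∈-cartesianProduct⁺; ∈-cartesianProduct⁻;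
         ∈-deduplicate⁺; ∈-deduplicate⁻; ∈-∃++)
open import Data.List.Membership.Propositional.Properties.WithK using (unique∧set⇒bag)
open import Data.List.Relation.Binary.BagAndSetEquality
  using (_∼[_]_; bag; [_]-Equality; >>=-cong; map-cong; ∼bag⇒↭)
open import Data.List.Relation.Binary.Permutation.Propositional
  using (_↭_; ↭-refl; ↭-prep; ↭-swap; ↭-sym; ↭-trans; ↭⇒↭ₛ)
open import Data.List.Relation.Binary.Permutation.Propositional.Properties
  using (↭-length; shift; filter-↭)
import Data.List.Relation.Binary.Permutation.Setoid.Properties as ↭ₛ
import Data.List.Relation.Unary.All as All
open All using (All; []; _∷_)
import Data.List.Relation.Unary.All.Properties as All
import Data.List.Relation.Unary.AllPairs as AllPairs
import Data.List.Relation.Unary.AllPairs.Properties as AllPairs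
open import Data.List.Relation.Unary.Any using (here; there)
open import Data.List.Relation.Unary.Unique.Propositional using (Unique; []; _∷_)
import Data.List.Relation.Unary.Unique.Propositional.Properties as Unique
import Data.List.Relation.Unary.Unique.DecPropositional as UniqueDec
open import Data.List.Relation.Unary.Unique.DecPropositional.Properties using (deduplicate-!)
open import Data.Nat using (ℕ; zero; suc; pred; _+_; _∸_; _≤_; _<_; z≤n; s≤s; _≤?_; _<?_)
open import Data.Nat.Properties
  using (≤-refl; ≤-trans; ≤-reflexive; <⇒≤; <-irrefl; <-asym; ≰⇒>; 1+n≰n; n≤1+n; m≤m+n; m≤n+m;
         m<m+n; m≤n⇒m<n∨m≡n; m<n⇒0<n∸m; m≤n+o⇒m∸n≤o; suc-injective; +-identityʳ; +-suc; +-comm;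
         +-monoʳ-≤; +-∸-assoc; n∸n≡0; m+n∸n≡m; m+n∸m≡n; m∸n+n≡m)
open import Data.Product using (_×_; _,_; proj₁; proj₂; ∃; ∃₂; map₂)
open import Data.Sum using (inj₁; inj₂)
open import Function using (_∘_; mk⇔)
open import Function.Related.Propositional using (K-refl)
open import Relation.Binary.PropositionalEquality
  using (_≡_; _≢_; refl; sym; trans; cong; cong₂; subst; subst₂; setoid; module ≡-Reasoning)
import Relation.Binary.Reasoning.Setoid as SetoidReasoning
open import Relation.Nullary using (¬_; ¬?; Dec; yes; no; does; _×-dec_)
open import Relation.Nullary.Decidable using (dec-true; dec-false)
open import Relation.Unary using (Pred; Decidable)

module _ {A : Set} where

  insAt : ℕ → A → List A → List A
  insAt zero    x ys       = x ∷ ys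
  insAt (suc i) x []       = x ∷ []
  insAt (suc i) x (y ∷ ys) = y ∷ insAt i x ys

  insAt-↭ : ∀ i (x : A) ys → insAt i x ys ↭ x ∷ ys
  insAt-↭ zero    x ys       = ↭-refl
  insAt-↭ (suc i) x []       = ↭-refl
  insAt-↭ (suc i) x (y ∷ ys) = ↭-trans (↭-prep y (insAt-↭ i x ys)) (↭-swap y x ↭-refl)

  insAt-++ : ∀ pre (x : A) suf → insAt (length pre) x (pre ++ suf) ≡ pre ++ x ∷ suf
  insAt-++ []        x suf = refl
  insAt-++ (y ∷ pre) x suf = cong (y ∷_) (insAt-++ pre x suf)

  Unique-insAt⁺ : ∀ i {x : A} {ys} → All (x ≢_) ys → Unique ys → Unique (insAt i x ys)
  Unique-insAt⁺ i {x} {ys} x∉ys u =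
    ↭ₛ.Unique-resp-↭ (setoid A) (↭⇒↭ₛ (↭-sym (insAt-↭ i x ys))) (x∉ys ∷ u)

  Unique-middle⁻ : ∀ xs {y : A} {zs} → Unique (xs ++ y ∷ zs) → All (y ≢_) (xs ++ zs) × Unique (xs ++ zs)
  Unique-middle⁻ xs {y} {zs} u
    with y∉ ∷ u′ ← ↭ₛ.Unique-resp-↭ (setoid A) (↭⇒↭ₛ (shift y xs zs)) u = y∉ , u′

module _ {A B : Set} where

  map-insAt : ∀ (f : A → B) i x ys → map f (insAt i x ys) ≡ insAt i (f x) (map f ys)
  map-insAt f zero    x ys       = refl
  map-insAt f (suc i) x []       = refl
  map-insAt f (suc i) x (y ∷ ys) = cong (f y ∷_) (map-insAt f i x ys)

  Unique-map⁺ : ∀ {f : A → B} {xs} → (∀ {x y} → x ∈ xs → y ∈ xs → f x ≡ f y → x ≡ y) →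
                Unique xs → Unique (map f xs)
  Unique-map⁺ {xs = []}     inj []       = []
  Unique-map⁺ {xs = x ∷ xs} inj (x∉ ∷ u) =
    All.map⁺ (All.tabulate λ y∈ fx≡fy → All.lookup x∉ y∈ (inj (here refl) (there y∈) fx≡fy))
    ∷ Unique-map⁺ (λ x∈ y∈ → inj (there x∈) (there y∈)) u

  Unique-concatMap⁺ : ∀ (f : A → List B) {xs} → Unique xs → (∀ x → Unique (f x)) →
                      (∀ {x y z} → z ∈ f x → z ∈ f y → x ≡ y) → Unique (concatMap f xs)
  Unique-concatMap⁺ f u uf disj = Unique.concat⁺
    (All.map⁺ (All.universal uf _))
    (AllPairs.map⁺ {f = f} (AllPairs.map (λ x≢y {_} (z∈ , z∈′) → x≢y (disj z∈ z∈′)) u))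

  length-filter-map : ∀ {p} {P : Pred B p} (P? : Decidable P) (f : A → B) xs →
                      length (filter P? (map f xs)) ≡ length (filter (P? ∘ f) xs)
  length-filter-map P? f []       = refl
  length-filter-map P? f (x ∷ xs) with does (P? (f x))
  ... | true  = cong suc (length-filter-map P? f xs)
  ... | false = length-filter-map P? f xs

  map-preimage : ∀ {f : A → B} {ys} → All (λ y → ∃ λ x → f x ≡ y) ys → ∃ λ xs → map f xs ≡ ys
  map-preimage []                 = [] , refl
  map-preimage ((x , refl) ∷ ps) with xs , refl ← map-preimage ps = x ∷ xs , refl

Unique⇒length≤ : ∀ {n} {vs : List (Fin n)} → Unique vs → length vs ≤ n
Unique⇒length≤ {n} {vs} u =
  subst₂ _≤_ (sym (↭-length (∼bag⇒↭ vs∼present))) (length-tabulate (λ i → i))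
    (length-filter present? (allFin n))
  where
  present? : Decidable (_∈ vs)
  present? v = DecMembership._∈?_ Fin._≟_ v vs
  vs∼present : vs ∼[ bag ] filter present? (allFin n)
  vs∼present = unique∧set⇒bag u (Unique.filter⁺ present? {allFin n} (Unique.allFin⁺ n))
    (mk⇔ (∈-filter⁺ present? (∈-allFin _)) (proj₂ ∘ ∈-filter⁻ present? {xs = allFin n}))

inject₁-preimage : ∀ {n} {v : Fin (suc n)} → fromℕ n ≢ v → ∃ λ u → inject₁ u ≡ v
inject₁-preimage {n} {v} fromℕ≢v = lower₁ v n≢v , inject₁-lower₁ v n≢v
  where
  n≢v : n ≢ toℕ v
  n≢v n≡v = fromℕ≢v (toℕ-injective (trans (toℕ-fromℕ n) n≡v))

fromℕ-∈ : ∀ {n} {vs : List (Fin (suc n))} → Unique vs → length vs ≡ suc n → fromℕ n ∈ vs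
fromℕ-∈ {n} {vs} u |vs|≡1+n with DecMembership._∈?_ Fin._≟_ (fromℕ n) vs
... | yes fromℕ∈vs = fromℕ∈vs
... | no  fromℕ∉vs
  with us , refl ← map-preimage (All.map inject₁-preimage (All.¬Any⇒All¬ vs fromℕ∉vs)) =
  ⊥-elim (1+n≰n (≤-trans (≤-reflexive (trans (sym |vs|≡1+n) (length-map inject₁ us)))
                          (Unique⇒length≤ (Unique.map⁻ u))))

inject₁<fromℕ : ∀ {n} (v : Fin n) → toℕ (inject₁ v) < toℕ (fromℕ n)
inject₁<fromℕ {n} v = subst (toℕ (inject₁ v) <_) (sym (toℕ-fromℕ n)) (inject₁ℕ< v)

inject₁-<⁺ : ∀ {n} {u u′ : Fin n} → toℕ u < toℕ u′ → toℕ (inject₁ u) < toℕ (inject₁ u′)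
inject₁-<⁺ {u = u} {u′} = subst₂ _<_ (sym (toℕ-inject₁ u)) (sym (toℕ-inject₁ u′))

inject₁-<⁻ : ∀ {n} {u u′ : Fin n} → toℕ (inject₁ u) < toℕ (inject₁ u′) → toℕ u < toℕ u′
inject₁-<⁻ {u = u} {u′} = subst₂ _<_ (toℕ-inject₁ u) (toℕ-inject₁ u′)

-- Colored permutations

module _ {A : Set} where

  ∈-words⁺ : ∀ {xs : List A} {w} → All (_∈ xs) w → w ∈ words (length w) xs
  ∈-words⁺      {w = []}    []        = here refl
  ∈-words⁺ {xs} {w = _ ∷ w} (x∈ ∷ w∈) =
    ∈-concat⁺′ (∈-map⁺ (_∷ w) x∈) (∈-map⁺ (λ v → map (_∷ v) xs) (∈-words⁺ w∈))

  ∈-words⁻ : ∀ {xs : List A} k {w} → w ∈ words k xs → length w ≡ k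
  ∈-words⁻      zero    (here refl) = refl
  ∈-words⁻ {xs} (suc k) w∈
    with ws , w∈ws , ws∈ ← ∈-concat⁻′ (map (λ v → map (_∷ v) xs) (words k xs)) w∈
    with v , v∈ , refl ← ∈-map⁻ (λ v → map (_∷ v) xs) ws∈
    with _ , _ , refl ← ∈-map⁻ (_∷ v) w∈ws
    = cong suc (∈-words⁻ k v∈)

  words-Unique : ∀ {xs : List A} k → Unique xs → Unique (words k xs)
  words-Unique      zero    u = [] ∷ []
  words-Unique {xs} (suc k) u =
    Unique-concatMap⁺ (λ v → map (_∷ v) xs) (words-Unique k u) (λ _ → Unique.map⁺ ∷-injectiveˡ u) same-tail
    where
    same-tail : ∀ {v v′ z} → z ∈ map (_∷ v) xs → z ∈ map (_∷ v′) xs → v ≡ v′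
    same-tail z∈ z∈′ with _ , _ , refl ← ∈-map⁻ _ z∈ with _ , _ , eq ← ∈-map⁻ _ z∈′ = ∷-injectiveʳ eq

Word : ℕ → ℕ → Set
Word m n = List (Fin m × Fin n)

module _ {m : ℕ} where

  open ≡-Reasoning

  ∈-coloredPerms⁺ : ∀ {n} {w : Word m n} → length w ≡ n → Unique (map proj₂ w) → w ∈ coloredPerms m n
  ∈-coloredPerms⁺ {n} {w} |w|≡n = ∈-filter⁺ (λ w → UniqueDec.unique? Fin._≟_ (map proj₂ w))
    (subst (λ k → w ∈ words k _) |w|≡n
      (∈-words⁺ (All.universal (λ (c , v) → ∈-cartesianProduct⁺ (∈-allFin c) (∈-allFin v)) w)))

  ∈-coloredPerms⁻ : ∀ {n} {w : Word m n} → w ∈ coloredPerms m n → length w ≡ n × Unique (map proj₂ w)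
  ∈-coloredPerms⁻ {n} w∈
    with w∈words , u ← ∈-filter⁻ (λ w → UniqueDec.unique? Fin._≟_ (map proj₂ w)) w∈ = ∈-words⁻ n w∈words , u

  coloredPerms-Unique : ∀ n → Unique (coloredPerms m n)
  coloredPerms-Unique n = Unique.filter⁺ (λ w → UniqueDec.unique? Fin._≟_ (map proj₂ w))
    (words-Unique n (Unique.cartesianProduct⁺ (Unique.allFin⁺ m) (Unique.allFin⁺ n)))

  lift : ∀ {n} → Word m n → Word m (suc n)
  lift = map (map₂ inject₁)

  values-lift : ∀ {n} (w : Word m n) → map proj₂ (lift w) ≡ map inject₁ (map proj₂ w)
  values-lift w = trans (sym (map-∘ w)) (map-∘ w)

  lift-injective : ∀ {n} {w w′ : Word m n} → lift w ≡ lift w′ → w ≡ w′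
  lift-injective = map-injective λ eq → cong₂ _,_ (cong proj₁ eq) (inject₁-injective (cong proj₂ eq))

  letter-preimage : ∀ {n} {y : Fin m × Fin (suc n)} → fromℕ n ≢ proj₂ y → ∃ λ x → map₂ inject₁ x ≡ y
  letter-preimage {y = c , _} fromℕ≢v with u , refl ← inject₁-preimage fromℕ≢v = (c , u) , refl

  slots : ℕ → List (ℕ × Fin m)
  slots k = cartesianProduct (upTo (suc k)) (allFin m)

  ∈-slots⁺ : ∀ {k s} → proj₁ s ≤ k → s ∈ slots k
  ∈-slots⁺ i≤k = ∈-cartesianProduct⁺ (∈-upTo⁺ (s≤s i≤k)) (∈-allFin _)

  ∈-slots⁻ : ∀ {k s} → s ∈ slots k → proj₁ s ≤ k
  ∈-slots⁻ {k} s∈ with s≤s i≤k ← ∈-upTo⁻ (proj₁ (∈-cartesianProduct⁻ (upTo (suc k)) (allFin m) s∈)) = i≤k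

  slots-Unique : ∀ k → Unique (slots k)
  slots-Unique k = Unique.cartesianProduct⁺ (Unique.upTo⁺ (suc k)) (Unique.allFin⁺ m)

  -- The new largest letter n+1 (that is, fromℕ n) gets colour c and is put after the first i letters.
  insertMax : ∀ {n} → ℕ × Fin m → Word m n → Word m (suc n)
  insertMax (i , c) w = insAt i (c , fromℕ _) (lift w)

  insertMax-injective : ∀ {n} {i i′ c c′} (w w′ : Word m n) → i ≤ length w → i′ ≤ length w′ →
                        insertMax (i , c) w ≡ insertMax (i′ , c′) w′ → (i , c) ≡ (i′ , c′) × w ≡ w′
  insertMax-injective {i = zero} {zero} w w′ _ _ eq
    with refl , tail ← ∷-injective eq = refl , lift-injective tail
  insertMax-injective {i = zero} {suc _} w (_ ∷ _) _ _ eq =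
    ⊥-elim (fromℕ≢inject₁ (cong proj₂ (∷-injectiveˡ eq)))
  insertMax-injective {i = suc _} {zero} (_ ∷ _) w′ _ _ eq =
    ⊥-elim (fromℕ≢inject₁ (sym (cong proj₂ (∷-injectiveˡ eq))))
  insertMax-injective {i = suc i} {suc i′} (x ∷ w) (x′ ∷ w′) (s≤s i≤) (s≤s i′≤) eq
    with head , tail ← ∷-injective eq
    with refl , refl ← insertMax-injective w w′ i≤ i′≤ tail
    with refl ← lift-injective {w = x ∷ []} {x′ ∷ []} (cong (_∷ []) head)
    = refl , refl

  insertions : ∀ {n} → Word m n → List (Word m (suc n))
  insertions w = map (λ s → insertMax s w) (slots (length w))

  insertions-Unique : ∀ {n} (w : Word m n) → Unique (insertions w)
  insertions-Unique w = Unique-map⁺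
    (λ s∈ s′∈ eq → proj₁ (insertMax-injective w w (∈-slots⁻ s∈) (∈-slots⁻ s′∈) eq))
    (slots-Unique (length w))

  insertMax-∈-coloredPerms : ∀ {n} s {w : Word m n} → w ∈ coloredPerms m n →
                             insertMax s w ∈ coloredPerms m (suc n)
  insertMax-∈-coloredPerms {n} (i , c) {w} w∈ with |w|≡n , u ← ∈-coloredPerms⁻ w∈ =
    ∈-coloredPerms⁺ |insertMax|≡1+n
      (subst Unique (sym (map-insAt proj₂ i (c , fromℕ n) (lift w)))
        (Unique-insAt⁺ i
          (subst (All (fromℕ n ≢_)) (sym (values-lift w)) (All.map⁺ (All.universal (λ _ → fromℕ≢inject₁) _)))
          (subst Unique (sym (values-lift w)) (Unique.map⁺ inject₁-injective u))))
    where
    |insertMax|≡1+n : length (insertMax (i , c) w) ≡ suc n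
    |insertMax|≡1+n = trans (↭-length (insAt-↭ i _ (lift w))) (cong suc (trans (length-map _ w) |w|≡n))

  ∈-coloredPerms-suc⁻ : ∀ {n} {w : Word m (suc n)} → w ∈ coloredPerms m (suc n) →
                        ∃₂ λ w′ s → w′ ∈ coloredPerms m n × s ∈ slots (length w′) × insertMax s w′ ≡ w
  ∈-coloredPerms-suc⁻ {n} {w} w∈
    with |w|≡1+n , u ← ∈-coloredPerms⁻ w∈
    with (c , _) , x∈w , refl ← ∈-map⁻ proj₂ (fromℕ-∈ u (trans (length-map proj₂ w) |w|≡1+n))
    with pre , suf , refl ← ∈-∃++ x∈w
    with fromℕ∉ , u′ ← Unique-middle⁻ (map proj₂ pre) (subst Unique (map-++ proj₂ pre _) u)
    with w′ , lift-w′ ← map-preimage (All.map letter-preimage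
                          (All.map⁻ (subst (All (fromℕ n ≢_)) (sym (map-++ proj₂ pre suf)) fromℕ∉)))
    = w′ , (length pre , c) , w′∈ , ∈-slots⁺ {s = length pre , c} |pre|≤|w′| , insertMax≡
    where
    |w′|≡|pre++suf| : length w′ ≡ length (pre ++ suf)
    |w′|≡|pre++suf| = trans (sym (length-map _ w′)) (cong length lift-w′)
    values-w′ : map proj₂ pre ++ map proj₂ suf ≡ map inject₁ (map proj₂ w′)
    values-w′ = trans (sym (map-++ proj₂ pre suf)) (trans (cong (map proj₂) (sym lift-w′)) (values-lift w′))
    w′∈ : w′ ∈ coloredPerms m n
    w′∈ = ∈-coloredPerms⁺
      (trans |w′|≡|pre++suf| (suc-injective (trans (sym (↭-length (shift _ pre suf))) |w|≡1+n)))
      (Unique.map⁻ (subst Unique values-w′ u′))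
    |pre|≤|w′| : length pre ≤ length w′
    |pre|≤|w′| = subst (length pre ≤_) (sym |w′|≡|pre++suf|) (length-++-≤ˡ pre)
    insertMax≡ : insertMax (length pre , c) w′ ≡ pre ++ (c , fromℕ n) ∷ suf
    insertMax≡ = trans (cong (insAt (length pre) (c , fromℕ n)) lift-w′) (insAt-++ pre _ suf)

  coloredPerms-suc : ∀ n → coloredPerms m (suc n) ∼[ bag ] concatMap insertions (coloredPerms m n)
  coloredPerms-suc n = unique∧set⇒bag (coloredPerms-Unique (suc n))
    (Unique-concatMap⁺ insertions (coloredPerms-Unique n) insertions-Unique same-origin)
    (mk⇔ from-perm to-perm)
    where
    same-origin : ∀ {w w′ : Word m n} {z} → z ∈ insertions w → z ∈ insertions w′ → w ≡ w′
    same-origin z∈ z∈′ with s , s∈ , refl ← ∈-map⁻ _ z∈ with s′ , s′∈ , eq ← ∈-map⁻ _ z∈′ =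
      proj₂ (insertMax-injective _ _ (∈-slots⁻ s∈) (∈-slots⁻ s′∈) eq)
    from-perm : ∀ {w} → w ∈ coloredPerms m (suc n) → w ∈ concatMap insertions (coloredPerms m n)
    from-perm w∈ with w′ , s , w′∈ , s∈ , refl ← ∈-coloredPerms-suc⁻ w∈ =
      ∈-concat⁺′ (∈-map⁺ (λ s → insertMax s w′) s∈) (∈-map⁺ insertions w′∈)
    to-perm : ∀ {z} → z ∈ concatMap insertions (coloredPerms m n) → z ∈ coloredPerms m (suc n)
    to-perm z∈
      with zs , z∈zs , zs∈ ← ∈-concat⁻′ (map insertions (coloredPerms m n)) z∈
      with w , w∈ , refl ← ∈-map⁻ insertions zs∈
      with s , _ , refl ← ∈-map⁻ _ z∈zs
      = insertMax-∈-coloredPerms s w∈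

  -- Colored descent compositions

  nonzeroPart : Fin m → ℕ → Comp m
  nonzeroPart ε k = dropZeros ((ε , k) ∷ [])

  -- The colored descent composition of insertMax (i , c) w in terms of the one of w: the new letter
  -- ends the run of the i-th letter of w, and belongs to that run exactly when it has the same colour.
  coverAt : ℕ × Fin m → Comp m → Comp m
  coverAt (zero  , c) α             = (c , 1) ∷ α
  coverAt (suc i , c) []            = []
  coverAt (suc i , c) ((ε , p) ∷ α) with suc i ≤? p | ε Fin.≟ c
  ... | yes _ | yes _ = (ε , suc (suc i)) ∷ nonzeroPart ε (p ∸ suc i) ++ α
  ... | yes _ | no  _ = (ε , suc i) ∷ (c , 1) ∷ nonzeroPart ε (p ∸ suc i) ++ α
  ... | no  _ | _     = (ε , p) ∷ coverAt (suc i ∸ p , c) α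

  coverAt-extend : ∀ {i ε p α} → suc i ≤ p →
                   coverAt (suc i , ε) ((ε , p) ∷ α) ≡ (ε , suc (suc i)) ∷ nonzeroPart ε (p ∸ suc i) ++ α
  coverAt-extend {i} {ε} {p} i<p with suc i ≤? p | ε Fin.≟ ε
  ... | yes _   | yes _   = refl
  ... | yes _   | no  ε≢ε = ⊥-elim (ε≢ε refl)
  ... | no  i≮p | _       = ⊥-elim (i≮p i<p)

  coverAt-interrupt : ∀ {i ε c p α} → suc i ≤ p → ε ≢ c →
                      coverAt (suc i , c) ((ε , p) ∷ α) ≡ (ε , suc i) ∷ (c , 1) ∷ nonzeroPart ε (p ∸ suc i) ++ α
  coverAt-interrupt {i} {ε} {c} {p} i<p ε≢c with suc i ≤? p | ε Fin.≟ c
  ... | yes _   | yes ε≡c = ⊥-elim (ε≢c ε≡c)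
  ... | yes _   | no  _   = refl
  ... | no  i≮p | _       = ⊥-elim (i≮p i<p)

  coverAt-later : ∀ {i ε c p α} → p < suc i →
                  coverAt (suc i , c) ((ε , p) ∷ α) ≡ (ε , p) ∷ coverAt (suc i ∸ p , c) α
  coverAt-later {i} {ε} {c} {p} p≤i with suc i ≤? p | ε Fin.≟ c
  ... | yes i<p | _ = ⊥-elim (<-irrefl refl (≤-trans p≤i i<p))
  ... | no  _   | _ = refl

  data CoverAtView (ε : Fin m) (p : ℕ) (α : Comp m) : ℕ × Fin m → Comp m → Set where
    front     : ∀ {c} → CoverAtView ε p α (0 , c) ((c , 1) ∷ (ε , p) ∷ α)
    extend    : ∀ {k} → suc k ≤ p →
                CoverAtView ε p α (suc k , ε) ((ε , suc (suc k)) ∷ nonzeroPart ε (p ∸ suc k) ++ α)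
    interrupt : ∀ {k c} → suc k ≤ p → ε ≢ c →
                CoverAtView ε p α (suc k , c) ((ε , suc k) ∷ (c , 1) ∷ nonzeroPart ε (p ∸ suc k) ++ α)
    later     : ∀ {k c} → p < suc k → CoverAtView ε p α (suc k , c) ((ε , p) ∷ coverAt (suc k ∸ p , c) α)

  coverAt-view : ∀ ε p α s → CoverAtView ε p α s (coverAt s ((ε , p) ∷ α))
  coverAt-view ε p α (zero  , c) = front
  coverAt-view ε p α (suc k , c) with suc k ≤? p | ε Fin.≟ c
  ... | yes k<p | yes refl = extend k<p
  ... | yes k<p | no  ε≢c  = interrupt k<p ε≢c
  ... | no  k≮p | _        = later (≰⇒> k≮p)

  nonzeroPart-pos : ∀ {ε k} → 0 < k → nonzeroPart ε k ≡ (ε , k) ∷ []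
  nonzeroPart-pos {k = suc _} _ = refl

  descGo-continue : ∀ {n} c (v v′ : Fin n) len xs → toℕ v < toℕ v′ →
                    descGo {m} c v len ((c , v′) ∷ xs) ≡ descGo c v′ (suc len) xs
  descGo-continue c v v′ _ _ v<v′
    rewrite dec-true (c Fin.≟ c) refl | dec-true (toℕ v <? toℕ v′) v<v′ = refl

  descGo-break : ∀ {n} c c′ (v v′ : Fin n) len xs → ¬ (c ≡ c′ × toℕ v < toℕ v′) →
                 descGo {m} c v len ((c′ , v′) ∷ xs) ≡ (c , len) ∷ descGo c′ v′ 1 xs
  descGo-break c c′ v v′ _ _ stop with c Fin.≟ c′
  ... | no  _    = refl
  ... | yes refl rewrite dec-false (toℕ v <? toℕ v′) (λ v<v′ → stop (refl , v<v′)) = refl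

  module _ {n : ℕ} where

    descGo-lift : ∀ c (v : Fin n) len xs → descGo c (inject₁ v) len (lift xs) ≡ descGo {m} c v len xs
    descGo-lift c v len []               = refl
    descGo-lift c v len ((c′ , v′) ∷ xs) rewrite toℕ-inject₁ v | toℕ-inject₁ v′
      with does (c Fin.≟ c′) ∧ does (toℕ v <? toℕ v′)
    ... | true  = descGo-lift c v′ (suc len) xs
    ... | false = cong ((c , len) ∷_) (descGo-lift c′ v′ 1 xs)

    descGo-fromℕ : ∀ c len (xs : Word m n) → descGo c (fromℕ n) len (lift xs) ≡ (c , len) ∷ coloredDescComp xs
    descGo-fromℕ c len []               = refl
    descGo-fromℕ c len ((c′ , v′) ∷ xs) = trans
      (descGo-break c c′ (fromℕ n) (inject₁ v′) len (lift xs)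
        λ (_ , n<v′) → <-asym (inject₁ℕ< v′) (subst (_< toℕ (inject₁ v′)) (toℕ-fromℕ n) n<v′))
      (cong ((c , len) ∷_) (descGo-lift c′ v′ 1 xs))

    -- The current run absorbs the next r letters; R is the composition of the letters after those.
    descGo-run : ∀ c (v : Fin n) (xs : Word m n) →
                 ∃₂ λ r R → (∀ len → descGo c v len xs ≡ (c , r + len) ∷ R) ×
                            coloredDescComp xs ≡ nonzeroPart c r ++ R
    descGo-run c v []               = 0 , [] , (λ _ → refl) , refl
    descGo-run c v ((c′ , v′) ∷ xs) with (c Fin.≟ c′) ×-dec (toℕ v <? toℕ v′)
    ... | no stop = 0 , descGo c′ v′ 1 xs , (λ len → descGo-break c c′ v v′ len xs stop) , refl
    ... | yes (refl , v<v′) with r , R , run , _ ← descGo-run c v′ xs =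
      suc r , R ,
      (λ len → trans (descGo-continue c v v′ len xs v<v′)
                     (trans (run (suc len)) (cong (λ k → (c , k) ∷ R) (+-suc r len)))) ,
      trans (run 1) (cong (λ k → (c , k) ∷ R) (+-comm r 1))

    -- Generalised for the induction: the new letter goes j letters after v, the last letter of a run
    -- of length 1 + l.
    descGo-insAt : ∀ c* c (v : Fin n) l xs j → j ≤ length xs →
                   descGo c (inject₁ v) (suc l) (insAt j (c* , fromℕ n) (lift xs))
                   ≡ coverAt (j + suc l , c*) (descGo c v (suc l) xs)
    descGo-insAt c* c v l xs zero _ with r , R , run , rest ← descGo-run c v xs = run-end (c Fin.≟ c*)
      where
      run-end : Dec (c ≡ c*) → descGo c (inject₁ v) (suc l) ((c* , fromℕ n) ∷ lift xs)
                              ≡ coverAt (suc l , c*) (descGo c v (suc l) xs)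
      run-end (yes refl) = begin
        descGo c (inject₁ v) (suc l) ((c , fromℕ n) ∷ lift xs)
          ≡⟨ descGo-continue c (inject₁ v) (fromℕ n) (suc l) (lift xs) (inject₁<fromℕ v) ⟩
        descGo c (fromℕ n) (suc (suc l)) (lift xs)
          ≡⟨ descGo-fromℕ c _ xs ⟩
        (c , suc (suc l)) ∷ coloredDescComp xs
          ≡⟨ cong ((c , suc (suc l)) ∷_) rest ⟩
        (c , suc (suc l)) ∷ nonzeroPart c r ++ R
          ≡⟨ cong (λ k → (c , suc (suc l)) ∷ nonzeroPart c k ++ R) (m+n∸n≡m r (suc l)) ⟨
        (c , suc (suc l)) ∷ nonzeroPart c (r + suc l ∸ suc l) ++ R
          ≡⟨ coverAt-extend (m≤n+m (suc l) r) ⟨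
        coverAt (suc l , c) ((c , r + suc l) ∷ R)
          ≡⟨ cong (coverAt (suc l , c)) (run (suc l)) ⟨
        coverAt (suc l , c) (descGo c v (suc l) xs) ∎
      run-end (no c≢c*) = begin
        descGo c (inject₁ v) (suc l) ((c* , fromℕ n) ∷ lift xs)
          ≡⟨ descGo-break c c* (inject₁ v) (fromℕ n) (suc l) (lift xs) (c≢c* ∘ proj₁) ⟩
        (c , suc l) ∷ descGo c* (fromℕ n) 1 (lift xs)
          ≡⟨ cong ((c , suc l) ∷_) (descGo-fromℕ c* 1 xs) ⟩
        (c , suc l) ∷ (c* , 1) ∷ coloredDescComp xs
          ≡⟨ cong (λ β → (c , suc l) ∷ (c* , 1) ∷ β) rest ⟩
        (c , suc l) ∷ (c* , 1) ∷ nonzeroPart c r ++ R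
          ≡⟨ cong (λ k → (c , suc l) ∷ (c* , 1) ∷ nonzeroPart c k ++ R) (m+n∸n≡m r (suc l)) ⟨
        (c , suc l) ∷ (c* , 1) ∷ nonzeroPart c (r + suc l ∸ suc l) ++ R
          ≡⟨ coverAt-interrupt (m≤n+m (suc l) r) c≢c* ⟨
        coverAt (suc l , c*) ((c , r + suc l) ∷ R)
          ≡⟨ cong (coverAt (suc l , c*)) (run (suc l)) ⟨
        coverAt (suc l , c*) (descGo c v (suc l) xs) ∎
    descGo-insAt c* c v l ((c′ , v′) ∷ xs) (suc j) (s≤s j≤) with (c Fin.≟ c′) ×-dec (toℕ v <? toℕ v′)
    ... | yes (refl , v<v′) = begin
      descGo c (inject₁ v) (suc l) ((c , inject₁ v′) ∷ ins)
        ≡⟨ descGo-continue c (inject₁ v) (inject₁ v′) (suc l) ins (inject₁-<⁺ v<v′) ⟩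
      descGo c (inject₁ v′) (suc (suc l)) ins
        ≡⟨ descGo-insAt c* c v′ (suc l) xs j j≤ ⟩
      coverAt (j + suc (suc l) , c*) (descGo c v′ (suc (suc l)) xs)
        ≡⟨ cong (λ k → coverAt (k , c*) (descGo c v′ (suc (suc l)) xs)) (+-suc j (suc l)) ⟩
      coverAt (suc j + suc l , c*) (descGo c v′ (suc (suc l)) xs)
        ≡⟨ cong (coverAt (suc j + suc l , c*)) (descGo-continue c v v′ (suc l) xs v<v′) ⟨
      coverAt (suc j + suc l , c*) (descGo c v (suc l) ((c , v′) ∷ xs)) ∎
      where
      ins : Word m (suc n)
      ins = insAt j (c* , fromℕ n) (lift xs)
    ... | no stop = begin
      descGo c (inject₁ v) (suc l) ((c′ , inject₁ v′) ∷ ins)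
        ≡⟨ descGo-break c c′ (inject₁ v) (inject₁ v′) (suc l) ins (λ (e , lt) → stop (e , inject₁-<⁻ lt)) ⟩
      (c , suc l) ∷ descGo c′ (inject₁ v′) 1 ins
        ≡⟨ cong ((c , suc l) ∷_) (descGo-insAt c* c′ v′ 0 xs j j≤) ⟩
      (c , suc l) ∷ coverAt (j + 1 , c*) (descGo c′ v′ 1 xs)
        ≡⟨ cong (λ k → (c , suc l) ∷ coverAt (k , c*) (descGo c′ v′ 1 xs))
                (trans (+-comm j 1) (sym (m+n∸n≡m (suc j) (suc l)))) ⟩
      (c , suc l) ∷ coverAt (suc j + suc l ∸ suc l , c*) (descGo c′ v′ 1 xs)
        ≡⟨ coverAt-later (s≤s (m≤n+m (suc l) j)) ⟨
      coverAt (suc j + suc l , c*) ((c , suc l) ∷ descGo c′ v′ 1 xs)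
        ≡⟨ cong (coverAt (suc j + suc l , c*)) (descGo-break c c′ v v′ (suc l) xs stop) ⟨
      coverAt (suc j + suc l , c*) (descGo c v (suc l) ((c′ , v′) ∷ xs)) ∎
      where
      ins : Word m (suc n)
      ins = insAt j (c* , fromℕ n) (lift xs)

    coloredDescComp-insertMax : ∀ s (w : Word m n) → proj₁ s ≤ length w →
                                coloredDescComp (insertMax s w) ≡ coverAt s (coloredDescComp w)
    coloredDescComp-insertMax (zero  , c) []             _        = refl
    coloredDescComp-insertMax (zero  , c) (x ∷ w)        _        = descGo-fromℕ c 1 (x ∷ w)
    coloredDescComp-insertMax (suc j , c) ((c′ , v) ∷ w) (s≤s j≤) =
      trans (descGo-insAt c c′ v 0 w j j≤) (cong (λ k → coverAt (k , c) (descGo c′ v 1 w)) (+-comm j 1))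

    size-descGo : ∀ c (v : Fin n) len xs → size (descGo {m} c v len xs) ≡ len + length xs
    size-descGo c v len []               = refl
    size-descGo c v len ((c′ , v′) ∷ xs) with (c Fin.≟ c′) ×-dec (toℕ v <? toℕ v′)
    ... | yes (refl , v<v′) = begin
      size (descGo c v len ((c , v′) ∷ xs)) ≡⟨ cong size (descGo-continue c v v′ len xs v<v′) ⟩
      size (descGo c v′ (suc len) xs)       ≡⟨ size-descGo c v′ (suc len) xs ⟩
      suc len + length xs                   ≡⟨ +-suc len (length xs) ⟨
      len + suc (length xs)                 ∎
    ... | no stop =
      trans (cong size (descGo-break c c′ v v′ len xs stop)) (cong (len +_) (size-descGo c′ v′ 1 xs))

    size-coloredDescComp : ∀ (w : Word m n) → size (coloredDescComp w) ≡ length w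
    size-coloredDescComp []            = refl
    size-coloredDescComp ((c , v) ∷ w) = size-descGo c v 1 w

    descGo-IsComp : ∀ c (v : Fin n) len xs → IsComp (descGo {m} c v (suc len) xs)
    descGo-IsComp c v len []               = s≤s z≤n ∷ []
    descGo-IsComp c v len ((c′ , v′) ∷ xs) with (c Fin.≟ c′) ×-dec (toℕ v <? toℕ v′)
    ... | yes (refl , v<v′) =
      subst IsComp (sym (descGo-continue c v v′ (suc len) xs v<v′)) (descGo-IsComp c v′ (suc len) xs)
    ... | no stop =
      subst IsComp (sym (descGo-break c c′ v v′ (suc len) xs stop)) (s≤s z≤n ∷ descGo-IsComp c′ v′ 0 xs)

    coloredDescComp-IsComp : ∀ (w : Word m n) → IsComp (coloredDescComp w)
    coloredDescComp-IsComp []            = []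
    coloredDescComp-IsComp ((c , v) ∷ w) = descGo-IsComp c v 0 w

  -- Covers

  -- The function `step` local to coverCandidates, restated so that it can be reasoned about.
  coverStep : Comp m × (Fin m × ℕ) × Comp m → List (Comp m)
  coverStep (pre , (ε , a) , suf) =
    (pre ++ (ε , suc a) ∷ suf)
    ∷ map (λ h → pre ++ (ε , suc h) ∷ (ε , a ∸ h) ∷ suf) (upTo a)
    ++ concatMap (λ h →
         map (λ ε′ → pre ++ dropZeros ((ε , h) ∷ (ε′ , 1) ∷ (ε , a ∸ h) ∷ []) ++ suf)
             (filter (λ ε′ → ¬? (ε′ Fin.≟ ε)) (allFin m)))
       (upTo (suc a))

  coverStep-∷ : ∀ x pre y suf → coverStep (x ∷ pre , y , suf) ≡ map (x ∷_) (coverStep (pre , y , suf))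
  coverStep-∷ x pre (ε , a) suf = cong ((x ∷ pre ++ (ε , suc a) ∷ suf) ∷_) (sym (begin
    map (x ∷_) (map rule₂ (upTo a) ++ concatMap rule₃ (upTo (suc a)))
      ≡⟨ map-++ (x ∷_) (map rule₂ (upTo a)) _ ⟩
    map (x ∷_) (map rule₂ (upTo a)) ++ map (x ∷_) (concatMap rule₃ (upTo (suc a)))
      ≡⟨ cong₂ _++_ (sym (map-∘ (upTo a))) (map-concatMap (x ∷_) rule₃ (upTo (suc a))) ⟩
    map ((x ∷_) ∘ rule₂) (upTo a) ++ concatMap (map (x ∷_) ∘ rule₃) (upTo (suc a))
      ≡⟨ cong (map ((x ∷_) ∘ rule₂) (upTo a) ++_) (concatMap-cong (λ _ → sym (map-∘ others)) (upTo (suc a))) ⟩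
    _ ∎))
    where
    others : List (Fin m)
    others = filter (λ ε′ → ¬? (ε′ Fin.≟ ε)) (allFin m)
    rule₂ : ℕ → Comp m
    rule₂ h = pre ++ (ε , suc h) ∷ (ε , a ∸ h) ∷ suf
    rule₃ : ℕ → List (Comp m)
    rule₃ h = map (λ ε′ → pre ++ dropZeros ((ε , h) ∷ (ε′ , 1) ∷ (ε , a ∸ h) ∷ []) ++ suf) others

  firstPartCovers : Fin m × ℕ → Comp m → List (Comp m)
  firstPartCovers x α = coverStep ([] , x , α)

  coverCandidates-∷∷ : ∀ x y α →
    coverCandidates (x ∷ y ∷ α) ≡ firstPartCovers x (y ∷ α) ++ map (x ∷_) (coverCandidates (y ∷ α))
  coverCandidates-∷∷ x y α = cong (firstPartCovers x (y ∷ α) ++_) (begin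
    concatMap coverStep (map (λ { (p , z , s) → (x ∷ p , z , s) }) (splits (y ∷ α)))
      ≡⟨ concatMap-map coverStep _ (splits (y ∷ α)) ⟩
    concatMap (λ { (p , z , s) → coverStep (x ∷ p , z , s) }) (splits (y ∷ α))
      ≡⟨ concatMap-cong (λ { (p , z , s) → coverStep-∷ x p z s }) (splits (y ∷ α)) ⟩
    concatMap (map (x ∷_) ∘ coverStep) (splits (y ∷ α))
      ≡⟨ map-concatMap (x ∷_) coverStep (splits (y ∷ α)) ⟨
    map (x ∷_) (concatMap coverStep (splits (y ∷ α))) ∎)

  ∈-coverCandidates-head : ∀ {x α β} → β ∈ firstPartCovers x α → β ∈ coverCandidates (x ∷ α)
  ∈-coverCandidates-head {α = []}        β∈ = ∈-++⁺ˡ β∈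
  ∈-coverCandidates-head {x} {y ∷ α} {β} β∈ = subst (β ∈_) (sym (coverCandidates-∷∷ x y α)) (∈-++⁺ˡ β∈)

  ∈-coverCandidates-tail : ∀ {x y α β} → β ∈ coverCandidates (y ∷ α) → x ∷ β ∈ coverCandidates (x ∷ y ∷ α)
  ∈-coverCandidates-tail {x} {y} {α} {β} β∈ =
    subst (x ∷ β ∈_) (sym (coverCandidates-∷∷ x y α)) (∈-++⁺ʳ (firstPartCovers x (y ∷ α)) (∈-map⁺ (x ∷_) β∈))

  data FirstPartCover (ε : Fin m) (a : ℕ) (α : Comp m) : Comp m → Set where
    grow   : FirstPartCover ε a α ((ε , suc a) ∷ α)
    split  : ∀ h → h < a → FirstPartCover ε a α ((ε , suc h) ∷ (ε , a ∸ h) ∷ α)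
    insert : ∀ h ε′ → h < suc a → ε′ ≢ ε →
             FirstPartCover ε a α (dropZeros ((ε , h) ∷ (ε′ , 1) ∷ (ε , a ∸ h) ∷ []) ++ α)

  module _ {ε : Fin m} {a : ℕ} {α : Comp m} where

    private
      others : List (Fin m)
      others = filter (λ ε′ → ¬? (ε′ Fin.≟ ε)) (allFin m)
      rule₂ : ℕ → Comp m
      rule₂ h = (ε , suc h) ∷ (ε , a ∸ h) ∷ α
      rule₃ : ℕ → Fin m → Comp m
      rule₃ h ε′ = dropZeros ((ε , h) ∷ (ε′ , 1) ∷ (ε , a ∸ h) ∷ []) ++ α

    firstPartCover⁺ : ∀ {β} → FirstPartCover ε a α β → β ∈ firstPartCovers (ε , a) α
    firstPartCover⁺ grow                    = here refl
    firstPartCover⁺ (split h h<a)           = there (∈-++⁺ˡ (∈-map⁺ rule₂ (∈-upTo⁺ h<a)))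
    firstPartCover⁺ (insert h ε′ h≤a ε′≢ε) = there (∈-++⁺ʳ (map rule₂ (upTo a))
      (∈-concat⁺′ (∈-map⁺ (rule₃ h) (∈-filter⁺ (λ ε′ → ¬? (ε′ Fin.≟ ε)) (∈-allFin ε′) ε′≢ε))
                  (∈-map⁺ (λ h → map (rule₃ h) others) (∈-upTo⁺ h≤a))))

    firstPartCover⁻ : ∀ {β} → β ∈ firstPartCovers (ε , a) α → FirstPartCover ε a α β
    firstPartCover⁻ (here refl) = grow
    firstPartCover⁻ (there β∈) with ∈-++⁻ (map rule₂ (upTo a)) β∈
    ... | inj₁ β∈₂ with h , h∈ , refl ← ∈-map⁻ rule₂ β∈₂ = split h (∈-upTo⁻ h∈)
    ... | inj₂ β∈₃
      with βs , β∈βs , βs∈ ← ∈-concat⁻′ (map (λ h → map (rule₃ h) others) (upTo (suc a))) β∈₃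
      with h , h∈ , refl ← ∈-map⁻ (λ h → map (rule₃ h) others) βs∈
      with ε′ , ε′∈ , refl ← ∈-map⁻ (rule₃ h) β∈βs
      = insert h ε′ (∈-upTo⁻ h∈) (proj₂ (∈-filter⁻ (λ ε′ → ¬? (ε′ Fin.≟ ε)) {xs = allFin m} ε′∈))

  IsCoverAt : Comp m → Comp m → Set
  IsCoverAt α β = ∃ λ s → proj₁ s ≤ size α × coverAt s α ≡ β

  firstPartCover⇒IsCoverAt : ∀ {ε p α β} → FirstPartCover ε (suc p) α β → IsCoverAt ((ε , suc p) ∷ α) β
  firstPartCover⇒IsCoverAt {ε} {p} {α} grow =
    (suc p , ε) , m≤m+n _ _ ,
    trans (coverAt-extend ≤-refl) (cong (λ k → (ε , suc (suc p)) ∷ nonzeroPart ε k ++ α) (n∸n≡0 p))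
  firstPartCover⇒IsCoverAt (split zero _) = (0 , _) , z≤n , refl
  firstPartCover⇒IsCoverAt {ε} {α = α} (split (suc h) h<a) =
    (suc h , ε) , ≤-trans (<⇒≤ h<a) (m≤m+n _ _) ,
    trans (coverAt-extend (<⇒≤ h<a)) (cong (λ β → (ε , suc (suc h)) ∷ β ++ α) (nonzeroPart-pos (m<n⇒0<n∸m h<a)))
  firstPartCover⇒IsCoverAt (insert zero ε′ _ _) = (0 , ε′) , z≤n , refl
  firstPartCover⇒IsCoverAt (insert (suc h) ε′ (s≤s h≤p) ε′≢ε) =
    (suc h , ε′) , ≤-trans h≤p (m≤m+n _ _) , coverAt-interrupt h≤p (ε′≢ε ∘ sym)

  split-last-IsCoverAt : ∀ {ε p α} → IsCoverAt ((ε , suc p) ∷ α) ((ε , suc p) ∷ (ε , 1) ∷ α)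
  split-last-IsCoverAt {p = zero}      = (0 , _) , z≤n , refl
  split-last-IsCoverAt {ε} {suc q} {α} =
    (suc q , ε) , ≤-trans (n≤1+n _) (m≤m+n _ _) ,
    trans (coverAt-extend (n≤1+n (suc q))) (cong (λ k → (ε , suc (suc q)) ∷ nonzeroPart ε k ++ α) (m+n∸n≡m 1 q))

  -- A part c·1 put in front of the tail y ∷ α is an insertion after the last letter of the first part.
  ∷-IsCoverAt : ∀ {ε p y α β} → IsCoverAt (y ∷ α) β → IsCoverAt ((ε , suc p) ∷ y ∷ α) ((ε , suc p) ∷ β)
  ∷-IsCoverAt {ε} {p} {y} {α} ((suc j , c) , j≤ , refl) =
    (suc p + suc j , c) , +-monoʳ-≤ (suc p) j≤ ,
    trans (coverAt-later (s≤s (m<m+n p (s≤s z≤n))))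
          (cong (λ k → (ε , suc p) ∷ coverAt (k , c) (y ∷ α)) (m+n∸m≡n (suc p) (suc j)))
  ∷-IsCoverAt {ε} {p} {y} {α} ((zero , c) , _ , refl) with ε Fin.≟ c
  ... | no ε≢c   = (suc p , c) , m≤m+n _ _ ,
    trans (coverAt-interrupt ≤-refl ε≢c)
          (cong (λ k → (ε , suc p) ∷ (c , 1) ∷ nonzeroPart ε k ++ y ∷ α) (n∸n≡0 p))
  ... | yes refl = split-last-IsCoverAt

  ∈-coverCandidates⁻ : ∀ {α β} → IsComp α → β ∈ coverCandidates α → IsCoverAt α β
  ∈-coverCandidates⁻ {[]} _ β∈ with ε , _ , refl ← ∈-map⁻ (λ ε → (ε , 1) ∷ []) β∈ = (0 , ε) , z≤n , refl
  ∈-coverCandidates⁻ {(ε , suc p) ∷ []} (_ ∷ []) β∈ with ∈-++⁻ (firstPartCovers (ε , suc p) []) β∈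
  ... | inj₁ β∈₁ = firstPartCover⇒IsCoverAt (firstPartCover⁻ β∈₁)
  ∈-coverCandidates⁻ {(ε , suc p) ∷ y ∷ α} {β} (_ ∷ pos) β∈
    with ∈-++⁻ (firstPartCovers (ε , suc p) (y ∷ α)) (subst (β ∈_) (coverCandidates-∷∷ (ε , suc p) y α) β∈)
  ... | inj₁ β∈₁ = firstPartCover⇒IsCoverAt (firstPartCover⁻ β∈₁)
  ... | inj₂ β∈₂ with β′ , β′∈ , refl ← ∈-map⁻ ((ε , suc p) ∷_) β∈₂ = ∷-IsCoverAt (∈-coverCandidates⁻ pos β′∈)

  coverAtView-∈-coverCandidates :
    ∀ {ε p α s β} → CoverAtView ε (suc p) α s β → proj₁ s ≤ suc p + size α →
    (∀ {k c} → suc p < suc k → suc k ≤ suc p + size α →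
               (ε , suc p) ∷ coverAt (suc k ∸ suc p , c) α ∈ coverCandidates ((ε , suc p) ∷ α)) →
    β ∈ coverCandidates ((ε , suc p) ∷ α)
  coverAtView-∈-coverCandidates {ε} (front {c}) _ _ with ε Fin.≟ c
  ... | yes refl = ∈-coverCandidates-head (firstPartCover⁺ (split 0 (s≤s z≤n)))
  ... | no  ε≢c  = ∈-coverCandidates-head (firstPartCover⁺ (insert 0 c (s≤s z≤n) (ε≢c ∘ sym)))
  coverAtView-∈-coverCandidates {ε} {p} {α} (extend {k} k<p) _ _ with m≤n⇒m<n∨m≡n k<p
  ... | inj₁ k+1<p = subst (_∈ coverCandidates ((ε , suc p) ∷ α))
                       (cong (λ β → (ε , suc (suc k)) ∷ β ++ α) (sym (nonzeroPart-pos (m<n⇒0<n∸m k+1<p))))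
                       (∈-coverCandidates-head (firstPartCover⁺ (split (suc k) k+1<p)))
  ... | inj₂ refl  = subst (_∈ coverCandidates ((ε , suc p) ∷ α))
                       (cong (λ j → (ε , suc (suc k)) ∷ nonzeroPart ε j ++ α) (sym (n∸n≡0 k)))
                       (∈-coverCandidates-head (firstPartCover⁺ grow))
  coverAtView-∈-coverCandidates (interrupt {k} {c} k<p ε≢c) _ _ =
    ∈-coverCandidates-head (firstPartCover⁺ (insert (suc k) c (s≤s k<p) (ε≢c ∘ sym)))
  coverAtView-∈-coverCandidates (later p<k) k≤ in-tail = in-tail p<k k≤

  coverAt-∈-coverCandidates : ∀ {α} s → IsComp α → proj₁ s ≤ size α → coverAt s α ∈ coverCandidates α
  coverAt-∈-coverCandidates {[]} (zero , c) _ _ = ∈-map⁺ (λ ε → (ε , 1) ∷ []) (∈-allFin c)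
  coverAt-∈-coverCandidates {(ε , suc p) ∷ []} s (_ ∷ []) s≤ =
    coverAtView-∈-coverCandidates (coverAt-view ε (suc p) [] s) s≤
      λ p<k k≤ → ⊥-elim (<-irrefl refl (≤-trans p<k (subst (_≤_ _) (+-identityʳ (suc p)) k≤)))
  coverAt-∈-coverCandidates {(ε , suc p) ∷ y ∷ α} s (_ ∷ pos) s≤ =
    coverAtView-∈-coverCandidates (coverAt-view ε (suc p) (y ∷ α) s) s≤
      λ {k} {c} _ k≤ → ∈-coverCandidates-tail
        (coverAt-∈-coverCandidates (suc k ∸ suc p , c) pos (m≤n+o⇒m∸n≤o (suc k) (suc p) k≤))

  second-colour : ∀ {x x′ y y′ : Fin m × ℕ} {γ γ′} → x ∷ y ∷ γ ≡ x′ ∷ y′ ∷ γ′ → proj₁ y ≡ proj₁ y′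
  second-colour eq = cong proj₁ (∷-injectiveˡ (∷-injectiveʳ eq))

  coverAt≢front  : ∀ α {j c d} → coverAt (suc j , c) α ≢ (d , 1) ∷ α
  coverAt∸≢front : ∀ α {p k c d} → p < suc k → coverAt (suc k ∸ p , c) α ≢ (d , 1) ∷ α

  coverAt≢front []            ()
  coverAt≢front ((ε , p) ∷ α) {j} {c} {d} = go (coverAt-view ε p α (suc j , c))
    where
    go : ∀ {β} → CoverAtView ε p α (suc j , c) β → β ≢ (d , 1) ∷ (ε , p) ∷ α
    go (extend _)        ()
    go (interrupt _ ε≢c) eq = ε≢c (sym (second-colour eq))
    go (later p<k)       eq = coverAt∸≢front α p<k
      (trans (∷-injectiveʳ eq) (cong (λ q → (ε , q) ∷ α) (cong proj₂ (∷-injectiveˡ eq))))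

  coverAt∸≢front α {p} {k} {c} (s≤s p≤k) eq =
    coverAt≢front α (trans (cong (λ i → coverAt (i , c) α) (sym (+-∸-assoc 1 p≤k))) eq)

  coverAt-injective : ∀ α {s s′} → proj₁ s ≤ size α → proj₁ s′ ≤ size α → coverAt s α ≡ coverAt s′ α → s ≡ s′
  coverAt-injective []            {zero , _} {zero , _} _ _ eq = cong (0 ,_) (cong proj₁ (∷-injectiveˡ eq))
  coverAt-injective ((ε , p) ∷ α) {s} {s′} s≤ s′≤ = go (coverAt-view ε p α s) (coverAt-view ε p α s′) s≤ s′≤
    where
    front≢later : ∀ {c k c′} → p < suc k → (c , 1) ∷ (ε , p) ∷ α ≢ (ε , p) ∷ coverAt (suc k ∸ p , c′) α
    front≢later p<k eq = coverAt∸≢front α p<k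
      (sym (trans (cong (λ q → (ε , q) ∷ α) (cong proj₂ (∷-injectiveˡ eq))) (∷-injectiveʳ eq)))

    extend≢interrupt : ∀ {k k′ c′} → suc k′ ≤ p → ε ≢ c′ →
      (ε , suc (suc k)) ∷ nonzeroPart ε (p ∸ suc k) ++ α
      ≢ (ε , suc k′) ∷ (c′ , 1) ∷ nonzeroPart ε (p ∸ suc k′) ++ α
    extend≢interrupt {k} k′<p ε≢c′ eq with refl ← suc-injective (cong proj₂ (∷-injectiveˡ eq)) =
      ε≢c′ (cong proj₁ (∷-injectiveˡ
        (trans (cong (_++ α) (sym (nonzeroPart-pos (m<n⇒0<n∸m k′<p)))) (∷-injectiveʳ eq))))

    extend≢later : ∀ {k k′ c′} → p < suc k′ →
      (ε , suc (suc k)) ∷ nonzeroPart ε (p ∸ suc k) ++ α ≢ (ε , p) ∷ coverAt (suc k′ ∸ p , c′) α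
    extend≢later {k} p<k′ eq =
      coverAt∸≢front α p<k′ (sym (trans (cong (λ j → nonzeroPart ε j ++ α) (sym p∸k≡1)) (∷-injectiveʳ eq)))
      where
      p∸k≡1 : p ∸ suc k ≡ 1
      p∸k≡1 = trans (cong (_∸ suc k) (sym (cong proj₂ (∷-injectiveˡ eq)))) (m+n∸n≡m 1 (suc k))

    interrupt≢later : ∀ {k c k′ c′} → p < suc k′ →
      (ε , suc k) ∷ (c , 1) ∷ nonzeroPart ε (p ∸ suc k) ++ α ≢ (ε , p) ∷ coverAt (suc k′ ∸ p , c′) α
    interrupt≢later {k} {c} p<k′ eq =
      coverAt∸≢front α p<k′
        (sym (trans (cong (λ j → (c , 1) ∷ nonzeroPart ε j ++ α) (sym p∸k≡0)) (∷-injectiveʳ eq)))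
      where
      p∸k≡0 : p ∸ suc k ≡ 0
      p∸k≡0 = trans (cong (_∸ suc k) (sym (cong proj₂ (∷-injectiveˡ eq)))) (n∸n≡0 (suc k))

    go : ∀ {s s′ β β′} → CoverAtView ε p α s β → CoverAtView ε p α s′ β′ →
         proj₁ s ≤ p + size α → proj₁ s′ ≤ p + size α → β ≡ β′ → s ≡ s′
    go front                front               _ _ eq = cong (0 ,_) (cong proj₁ (∷-injectiveˡ eq))
    go front                (extend _)          _ _ ()
    go front                (interrupt _ ε≢c′)  _ _ eq = ⊥-elim (ε≢c′ (second-colour eq))
    go front                (later p<k′)        _ _ eq = ⊥-elim (front≢later p<k′ eq)
    go (extend _)           front               _ _ ()
    go (extend _)           (extend _)          _ _ eq = cong (λ i → (pred i , ε)) (cong proj₂ (∷-injectiveˡ eq))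
    go (extend _)           (interrupt k′<p ε≢c′) _ _ eq = ⊥-elim (extend≢interrupt k′<p ε≢c′ eq)
    go (extend _)           (later p<k′)        _ _ eq = ⊥-elim (extend≢later p<k′ eq)
    go (interrupt _ ε≢c)    front               _ _ eq = ⊥-elim (ε≢c (sym (second-colour eq)))
    go (interrupt k<p ε≢c)  (extend _)          _ _ eq = ⊥-elim (extend≢interrupt k<p ε≢c (sym eq))
    go (interrupt _ _)      (interrupt _ _)     _ _ eq = cong₂ _,_ (cong proj₂ (∷-injectiveˡ eq)) (second-colour eq)
    go (interrupt _ _)      (later p<k′)        _ _ eq = ⊥-elim (interrupt≢later p<k′ eq)
    go (later p<k)          front               _ _ eq = ⊥-elim (front≢later p<k (sym eq))
    go (later p<k)          (extend _)          _ _ eq = ⊥-elim (extend≢later p<k (sym eq))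
    go (later p<k)          (interrupt _ _)     _ _ eq = ⊥-elim (interrupt≢later p<k (sym eq))
    go (later {k} p<k)      (later {k′} p<k′)   k≤ k′≤ eq
      with tail-eq ← coverAt-injective α (m≤n+o⇒m∸n≤o (suc k) p k≤) (m≤n+o⇒m∸n≤o (suc k′) p k′≤)
                                         (∷-injectiveʳ eq) =
      cong₂ _,_ (begin
        suc k          ≡⟨ m∸n+n≡m (<⇒≤ p<k) ⟨
        suc k ∸ p + p  ≡⟨ cong (_+ p) (cong proj₁ tail-eq) ⟩
        suc k′ ∸ p + p ≡⟨ m∸n+n≡m (<⇒≤ p<k′) ⟩
        suc k′         ∎)
        (cong proj₂ tail-eq)

  coversAt : Comp m → List (Comp m)
  coversAt α = map (λ s → coverAt s α) (slots (size α))

  coversAt∼covers : ∀ {α} → IsComp α → coversAt α ∼[ bag ] covers α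
  coversAt∼covers {α} pos = unique∧set⇒bag
    (Unique-map⁺ (λ s∈ s′∈ → coverAt-injective α (∈-slots⁻ s∈) (∈-slots⁻ s′∈)) (slots-Unique (size α)))
    (deduplicate-! _≟C_ (coverCandidates α))
    (mk⇔ to from)
    where
    to : ∀ {β} → β ∈ coversAt α → β ∈ covers α
    to β∈ with s , s∈ , refl ← ∈-map⁻ _ β∈ =
      ∈-deduplicate⁺ _≟C_ (coverAt-∈-coverCandidates s pos (∈-slots⁻ s∈))
    from : ∀ {β} → β ∈ covers α → β ∈ coversAt α
    from β∈ with s , s≤ , refl ← ∈-coverCandidates⁻ pos (∈-deduplicate⁻ _≟C_ (coverCandidates α) β∈) =
      ∈-map⁺ _ (∈-slots⁺ s≤)

  coloredDescComp-insertions : ∀ {n} (w : Word m n) →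
                               map coloredDescComp (insertions w) ≡ coversAt (coloredDescComp w)
  coloredDescComp-insertions w = begin
    map coloredDescComp (map (λ s → insertMax s w) (slots (length w)))
      ≡⟨ map-∘ (slots (length w)) ⟨
    map (λ s → coloredDescComp (insertMax s w)) (slots (length w))
      ≡⟨ map-cong-local (All.tabulate λ s∈ → coloredDescComp-insertMax _ w (∈-slots⁻ s∈)) ⟩
    map (λ s → coverAt s (coloredDescComp w)) (slots (length w))
      ≡⟨ cong (λ k → map (λ s → coverAt s (coloredDescComp w)) (slots k)) (size-coloredDescComp w) ⟨
    coversAt (coloredDescComp w) ∎

  -- Saturated chains

  tops-suc : ∀ k → map head (chainsFromEmpty {m} (suc k)) ≡ concatMap covers (map head (chainsFromEmpty {m} k))
  tops-suc k = begin
    map head (concatMap extendChain (chainsFromEmpty k))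
      ≡⟨ map-concatMap head extendChain (chainsFromEmpty k) ⟩
    concatMap (map head ∘ extendChain) (chainsFromEmpty k)
      ≡⟨ concatMap-cong (λ ch → trans (sym (map-∘ (covers (head ch)))) (map-id (covers (head ch))))
                        (chainsFromEmpty k) ⟩
    concatMap (covers ∘ head) (chainsFromEmpty k)
      ≡⟨ concatMap-map covers head (chainsFromEmpty k) ⟨
    concatMap covers (map head (chainsFromEmpty k)) ∎
    where
    extendChain : List⁺ (Comp m) → List (List⁺ (Comp m))
    extendChain ch = map (λ β → β ∷⁺ ch) (covers (head ch))

module _ {m : ℕ} where

  open SetoidReasoning ([ bag ]-Equality (Comp m))

  tops∼descents : ∀ n → map head (chainsFromEmpty {m} n) ∼[ bag ] map coloredDescComp (coloredPerms m n)
  tops∼descents zero    = K-refl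
  tops∼descents (suc n) = begin
    map head (chainsFromEmpty (suc n))
      ≡⟨ tops-suc n ⟩
    concatMap covers (map head (chainsFromEmpty n))
      ≈⟨ >>=-cong (tops∼descents n) (λ _ → K-refl) ⟩
    concatMap covers (map coloredDescComp (coloredPerms m n))
      ≡⟨ concatMap-map covers coloredDescComp (coloredPerms m n) ⟩
    concatMap (covers ∘ coloredDescComp) (coloredPerms m n)
      ≈⟨ >>=-cong {xs = coloredPerms m n} K-refl covers-descents ⟨
    concatMap (map coloredDescComp ∘ insertions) (coloredPerms m n)
      ≡⟨ map-concatMap coloredDescComp insertions (coloredPerms m n) ⟨
    map coloredDescComp (concatMap insertions (coloredPerms m n))
      ≈⟨ map-cong (λ _ → refl) (coloredPerms-suc n) ⟨
    map coloredDescComp (coloredPerms m (suc n)) ∎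
    where
    covers-descents : ∀ (w : Word m n) → map coloredDescComp (insertions w) ∼[ bag ] covers (coloredDescComp w)
    covers-descents w = subst (_∼[ bag ] covers (coloredDescComp w)) (sym (coloredDescComp-insertions w))
                              (coversAt∼covers (coloredDescComp-IsComp w))

corollary2p2 : (m : ℕ) → 1 ≤ m → (n : ℕ) → (α : Comp m) → IsComp α → size α ≡ n →
    numSatChains n α ≡ f m n α
corollary2p2 m _ n α _ _ = begin
  numSatChains n α
    ≡⟨ length-filter-map (_≟C α) head (chainsFromEmpty n) ⟨
  length (filter (_≟C α) (map head (chainsFromEmpty n)))
    ≡⟨ ↭-length (filter-↭ (_≟C α) (∼bag⇒↭ (tops∼descents n))) ⟩
  length (filter (_≟C α) (map coloredDescComp (coloredPerms m n)))
    ≡⟨ length-filter-map (_≟C α) coloredDescComp (coloredPerms m n) ⟩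
  f m n α ∎
  where open ≡-Reasoning
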